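{- (1) The subword patterns $1132$, $1232$, $1322$ and $1332$ are in the same strong Wilf class. (2) The subword patterns $1432$ and $1342$ are in the same strong Wilf class. Here two patterns are in the same strong Wilf class if for all $k\ge1$, $n\ge0$, $r\ge0$, the number of words in $[k]^n$ containing one of them exactly $r$ times equals the number containing the other exactly $r$ times.
   Context: $[k]^n$ is the set of words of length $n$ over $\{1,\dots,k\}$. An occurrence of a subword pattern $\tau$ of length $l$ in $\sigma=\sigma_1\cdots\sigma_n$ is an index $i$ such that the consecutive factor $\sigma_i\cdots\sigma_{i+l-1}$ is order-isomorphic to $\tau$ (same relative order and same equalities among positions); "containing exactly $r$ times" means having exactly $r$ occurrences. -}

module Defs where

open import Data.Nat using (ℕ; zero; suc; _+_; _≤_; _<_; _<ᵇ_; _≡ᵇ_)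
open import Data.Nat.Properties using (<-cmp)
open import Data.Bool using (Bool; true; false; _∧_; if_then_else_)
open import Data.Fin using (Fin; toℕ)
open import Data.List using (List; []; _∷_; length; map; concatMap; allFin; filter; take; drop; upTo; foldr)
open import Relation.Binary.PropositionalEquality using (_≡_)

cmp : ℕ → ℕ → ℕ
cmp a b = if a <ᵇ b then 0 else (if a ≡ᵇ b then 1 else 2)

pairsOK : List ℕ → List ℕ → Bool
pairsOK [] [] = true
pairsOK (a ∷ as) (b ∷ bs) =
  allPair a as b bs ∧ pairsOK as bs
  where
  allPair : ℕ → List ℕ → ℕ → List ℕ → Bool
  allPair x [] y [] = true
  allPair x (u ∷ us) y (v ∷ vs) = (cmp x u ≡ᵇ cmp y v) ∧ allPair x us y vs
  allPair x _ y _ = false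
pairsOK _ _ = false

orderIso : List ℕ → List ℕ → Bool
orderIso = pairsOK

occ : List ℕ → List ℕ → ℕ
occ τ [] = if orderIso τ [] then 1 else 0
occ τ (a ∷ σ) =
  (if (length τ ≤ᵇ' length (a ∷ σ)) ∧ orderIso τ (take (length τ) (a ∷ σ)) then 1 else 0)
  + occ τ σ
  where
  _≤ᵇ'_ : ℕ → ℕ → Bool
  m ≤ᵇ' n = m <ᵇ suc n

words : ℕ → ℕ → List (List ℕ)
words k zero = [] ∷ []
words k (suc n) = concatMap (λ (c : Fin k) → map (λ w → suc (toℕ c) ∷ w) (words k n)) (allFin k)

count : List ℕ → ℕ → ℕ → ℕ → ℕ
count τ k n r = foldr (λ w acc → (if occ τ w ≡ᵇ r then 1 else 0) + acc) 0 (words k n)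

StronglyWilfEquiv : List ℕ → List ℕ → Set
StronglyWilfEquiv τ ρ = ∀ (k n r : ℕ) → 1 ≤ k → count τ k n r ≡ count ρ k n r

-- For each of the pairs 1132/1232, 1232/1322, 1232/1332 and 1432/1342 there is an
-- involution of [k]^n exchanging the occurrences of the two patterns: scan the word from
-- the left and, at every occurrence x y z w of either pattern, replace the middle letters
-- y z by those of the matching occurrence of the other pattern (for 1232/1322 and
-- 1432/1342 simply exchange y and z), then continue from w.  Two occurrences of these
-- patterns never share more than one position, so the rewritten letters lie in no other
-- occurrence and the positions at which one of the two patterns occurs do not change,
-- only which of the two occurs there.  Hence the image of a word has as many occurrences
-- of one pattern as the word has of the other.  The equivalence of 1132 with 1322 and
-- with 1332 then follows by transitivity through 1232.

module Submission where

open import Defs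
open import Data.Bool using (Bool; true; false; if_then_else_; _∨_)
open import Data.Bool.Properties using (¬-not; not-¬; T-≡; ∨-zeroʳ)
open import Data.Empty using (⊥)
open import Data.Fin using (Fin; toℕ; fromℕ<)
open import Data.Fin.Properties using (toℕ-injective; toℕ<n; toℕ-fromℕ<)
open import Data.List
  using (List; []; _∷_; _++_; length; map; concatMap; take; drop; allFin; foldr; cartesianProductWith)
open import Data.List.Membership.Propositional using (_∈_)
open import Data.List.Membership.Propositional.Properties
  using (∈-map⁺; ∈-map⁻; ∈-allFin; ∈-cartesianProductWith⁺; ∈-cartesianProductWith⁻)
open import Data.List.Membership.Propositional.Properties.WithK using (unique∧set⇒bag)
open import Data.List.Properties using (map-∘; map-cong; ∷-injective)
open import Data.List.Relation.Binary.BagAndSetEquality using (∼bag⇒↭)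
open import Data.List.Relation.Binary.Permutation.Propositional using (_↭_)
import Data.List.Relation.Binary.Permutation.Propositional.Properties as ↭
open import Data.List.Relation.Unary.All using (All; []; _∷_)
open import Data.List.Relation.Unary.AllPairs using ([]; _∷_)
open import Data.List.Relation.Unary.Any using (here)
open import Data.List.Relation.Unary.Unique.Propositional using (Unique)
open import Data.List.Relation.Unary.Unique.Propositional.Properties using (cartesianProductWith⁺; allFin⁺)
import Data.List.Relation.Unary.Unique.Propositional.Properties as Unique
open import Data.Nat using (ℕ; zero; suc; _+_; _≤_; _≡ᵇ_; z≤n; s≤s)
open import Data.Nat.ListAction using (sum)
open import Data.Nat.ListAction.Properties using (sum-↭)
open import Data.Nat.Properties using (suc-injective; ≡ᵇ⇒≡; ≡⇒≡ᵇ)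
open import Data.Product using (_×_; _,_; proj₁; proj₂)
open import Function using (_∘_; mk⇔; Equivalence)
open import Relation.Binary.PropositionalEquality
  using (_≡_; refl; sym; trans; cong; cong₂; subst; module ≡-Reasoning)

-- Counting words through an involution

indicator : Bool → ℕ
indicator b = if b then 1 else 0

map-involution-↭ : {A : Set} {f : A → A} {xs : List A} →
  (∀ x → f (f x) ≡ x) → (∀ {x} → x ∈ xs → f x ∈ xs) → Unique xs → map f xs ↭ xs
map-involution-↭ {f = f} {xs} involutive closed unique =
  ∼bag⇒↭ (unique∧set⇒bag (Unique.map⁺ injective unique) unique (mk⇔ to from))
  where
  injective : ∀ {x y} → f x ≡ f y → x ≡ y
  injective {x} {y} fx≡fy = trans (sym (involutive x)) (trans (cong f fx≡fy) (involutive y))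
  to : ∀ {x} → x ∈ map f xs → x ∈ xs
  to x∈ with ∈-map⁻ f x∈
  ... | y , y∈xs , refl = closed y∈xs
  from : ∀ {x} → x ∈ xs → x ∈ map f xs
  from {x} x∈xs = subst (_∈ map f xs) (involutive x) (∈-map⁺ f (closed x∈xs))

InRange : ℕ → ℕ → Set
InRange k c = 1 ≤ c × c ≤ k

prepend : {k : ℕ} → Fin k → List ℕ → List ℕ
prepend c u = suc (toℕ c) ∷ u

words-suc : ∀ k n → words k (suc n) ≡ cartesianProductWith prepend (allFin k) (words k n)
words-suc k n = concatMap-map (allFin k)
  where
  concatMap-map : ∀ cs →
    concatMap (λ c → map (prepend c) (words k n)) cs ≡ cartesianProductWith prepend cs (words k n)
  concatMap-map [] = refl
  concatMap-map (c ∷ cs) = cong (_ ++_) (concatMap-map cs)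

prepend-injective : ∀ {k} {c c′ : Fin k} {u u′} →
  prepend c u ≡ prepend c′ u′ → c ≡ c′ × u ≡ u′
prepend-injective eq with ∷-injective eq
... | head≡ , tail≡ = toℕ-injective (suc-injective head≡) , tail≡

words-unique : ∀ k n → Unique (words k n)
words-unique k zero = [] ∷ []
words-unique k (suc n) rewrite words-suc k n =
  cartesianProductWith⁺ prepend prepend-injective (allFin⁺ k) (words-unique k n)

∈-words⁻ : ∀ {k} n {u} → u ∈ words k n → length u ≡ n × All (InRange k) u
∈-words⁻ zero (here refl) = refl , []
∈-words⁻ {k} (suc n) u∈ rewrite words-suc k n
  with c , u , _ , u∈ , refl ← ∈-cartesianProductWith⁻ prepend (allFin k) (words k n) u∈
  with length≡ , inRange ← ∈-words⁻ n u∈ = cong suc length≡ , (s≤s z≤n , toℕ<n c) ∷ inRange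

∈-words⁺ : ∀ {k} n {u} → length u ≡ n → All (InRange k) u → u ∈ words k n
∈-words⁺ zero {[]} _ _ = here refl
∈-words⁺ {k} (suc n) {suc a ∷ u} length≡ ((s≤s z≤n , a<k) ∷ inRange) rewrite words-suc k n =
  subst (_∈ cartesianProductWith prepend (allFin k) (words k n))
    (cong (λ b → suc b ∷ u) (toℕ-fromℕ< a<k))
    (∈-cartesianProductWith⁺ prepend (∈-allFin (fromℕ< a<k)) (∈-words⁺ n (suc-injective length≡) inRange))

foldr-+≡sum-map : {A : Set} (f : A → ℕ) (xs : List A) →
  foldr (λ x acc → f x + acc) 0 xs ≡ sum (map f xs)
foldr-+≡sum-map f [] = refl
foldr-+≡sum-map f (x ∷ xs) = cong (f x +_) (foldr-+≡sum-map f xs)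

count-≡-by-involution : ∀ τ ρ (f : List ℕ → List ℕ) → (∀ u → f (f u) ≡ u) →
  (∀ k n {u} → u ∈ words k n → f u ∈ words k n) → (∀ u → occ ρ (f u) ≡ occ τ u) →
  ∀ k n r → count τ k n r ≡ count ρ k n r
count-≡-by-involution τ ρ f involutive closed occ≡ k n r = begin
  count τ k n r                 ≡⟨ foldr-+≡sum-map (hits τ) W ⟩
  sum (map (hits τ) W)          ≡⟨ cong sum (map-cong hits-τ≗hits-ρ∘f W) ⟩
  sum (map (hits ρ ∘ f) W)      ≡⟨ cong sum (map-∘ W) ⟩
  sum (map (hits ρ) (map f W))  ≡⟨ sum-↭ (↭.map⁺ (hits ρ) f-permutes-W) ⟩
  sum (map (hits ρ) W)          ≡⟨ foldr-+≡sum-map (hits ρ) W ⟨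
  count ρ k n r                 ∎
  where
  open ≡-Reasoning
  W : List (List ℕ)
  W = words k n
  hits : List ℕ → List ℕ → ℕ
  hits π u = indicator (occ π u ≡ᵇ r)
  hits-τ≗hits-ρ∘f : ∀ u → hits τ u ≡ hits ρ (f u)
  hits-τ≗hits-ρ∘f u = cong (λ m → indicator (m ≡ᵇ r)) (sym (occ≡ u))
  f-permutes-W : map f W ↭ W
  f-permutes-W = map-involution-↭ involutive (closed k n) (words-unique k n)

-- Swapping the middle of marked windows

-- A window x y z w is passed as x, (y , z), w: only its middle pair is ever rewritten.
WindowPred : Set
WindowPred = ℕ → ℕ × ℕ → ℕ → Bool

holdsAtHead : WindowPred → List ℕ → Bool
holdsAtHead p (x ∷ y ∷ z ∷ w ∷ _) = p x (y , z) w
holdsAtHead p _ = false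

occurrences : WindowPred → List ℕ → ℕ
occurrences p [] = 0
occurrences p (x ∷ u) = indicator (holdsAtHead p (x ∷ u)) + occurrences p u

_∷²_ : ℕ × ℕ → List ℕ → List ℕ
(a , b) ∷² u = a ∷ b ∷ u

LetterPreserving : (ℕ → ℕ × ℕ → ℕ → ℕ × ℕ) → Set₁
LetterPreserving f = ∀ {P : ℕ → Set} {x y z w} →
  P x → P y → P z → P w → P (proj₁ (f x (y , z) w)) × P (proj₂ (f x (y , z) w))

module WindowSwap
  (marked : WindowPred)
  (swap : ℕ → ℕ × ℕ → ℕ → ℕ × ℕ)
  (swap-marked : ∀ {x m w} → marked x m w ≡ true → marked x (swap x m w) w ≡ true)
  (swap-involutive : ∀ {x m w} → marked x m w ≡ true → swap x (swap x m w) w ≡ m)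
  (no-overlap₁ : ∀ {x y z w r} → marked x (y , z) w ≡ true → marked y (z , w) r ≡ true → ⊥)
  (no-overlap₂ : ∀ {x y z w r s} → marked x (y , z) w ≡ true → marked z (w , r) s ≡ true → ⊥)
  where

  swapAll : List ℕ → List ℕ
  swapAfter : ℕ → List ℕ → List ℕ

  swapAll [] = []
  swapAll (x ∷ u) = x ∷ swapAfter x u

  swapAfter x u@(y ∷ z ∷ v@(w ∷ _)) =
    if marked x (y , z) w then swap x (y , z) w ∷² swapAll v else swapAll u
  swapAfter x u = u

  open ≡-Reasoning

  markedAtHead : List ℕ → Bool
  markedAtHead = holdsAtHead marked

  swapAfter-marked : ∀ {x y z w} u → marked x (y , z) w ≡ true →
    swapAfter x (y ∷ z ∷ w ∷ u) ≡ swap x (y , z) w ∷² swapAll (w ∷ u)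
  swapAfter-marked u h rewrite h = refl

  swapAfter-unmarked : ∀ {x} u → markedAtHead (x ∷ u) ≡ false → swapAfter x u ≡ swapAll u
  swapAfter-unmarked [] _ = refl
  swapAfter-unmarked (y ∷ []) _ = refl
  swapAfter-unmarked (y ∷ z ∷ []) _ = refl
  swapAfter-unmarked (y ∷ z ∷ w ∷ u) h rewrite h = refl

  unmarked-before₁ : ∀ {x y z w r} → marked y (z , w) r ≡ true → marked x (y , z) w ≡ false
  unmarked-before₁ h = ¬-not (λ h′ → no-overlap₁ h′ h)

  unmarked-before₂ : ∀ {x y z w r s} → marked z (w , r) s ≡ true → marked x (y , z) w ≡ false
  unmarked-before₂ h = ¬-not (λ h′ → no-overlap₂ h′ h)

  unmarked-after₁ : ∀ {x y z w} → marked x (y , z) w ≡ true →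
    ∀ u → markedAtHead (y ∷ z ∷ w ∷ u) ≡ false
  unmarked-after₁ h [] = refl
  unmarked-after₁ h (r ∷ _) = ¬-not (no-overlap₁ h)

  unmarked-after₂ : ∀ {x y z w} → marked x (y , z) w ≡ true →
    ∀ u → markedAtHead (z ∷ w ∷ u) ≡ false
  unmarked-after₂ h [] = refl
  unmarked-after₂ h (r ∷ []) = refl
  unmarked-after₂ h (r ∷ s ∷ _) = ¬-not (no-overlap₂ h)

  markedAtHead-∷∷swapAll : ∀ x y z u →
    markedAtHead (x ∷ y ∷ swapAll (z ∷ u)) ≡ markedAtHead (x ∷ y ∷ z ∷ u)
  markedAtHead-∷∷swapAll x y z (w ∷ a ∷ b ∷ u) with marked z (w , a) b in e
  ... | true  = trans (unmarked-before₂ (swap-marked e)) (sym (unmarked-before₂ e))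
  ... | false = refl
  markedAtHead-∷∷swapAll x y z [] = refl
  markedAtHead-∷∷swapAll x y z (w ∷ []) = refl
  markedAtHead-∷∷swapAll x y z (w ∷ a ∷ []) = refl

  markedAtHead-∷swapAll : ∀ x y u →
    markedAtHead (x ∷ swapAll (y ∷ u)) ≡ markedAtHead (x ∷ y ∷ u)
  markedAtHead-∷swapAll x y (z ∷ w ∷ a ∷ u) with marked y (z , w) a in e
  ... | true  = trans (unmarked-before₁ (swap-marked e)) (sym (unmarked-before₁ e))
  ... | false = markedAtHead-∷∷swapAll x y z (w ∷ a ∷ u)
  markedAtHead-∷swapAll x y [] = refl
  markedAtHead-∷swapAll x y (z ∷ []) = refl
  markedAtHead-∷swapAll x y (z ∷ w ∷ []) = refl

  swapAfter-swapAll : ∀ x y u → markedAtHead (x ∷ y ∷ u) ≡ false →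
    swapAfter x (swapAll (y ∷ u)) ≡ swapAll (swapAll (y ∷ u))
  swapAfter-swapAll x y u h =
    swapAfter-unmarked (swapAll (y ∷ u)) (trans (markedAtHead-∷swapAll x y u) h)

  -- Here and below the induction hypotheses are taken in the with-head: made from the
  -- with-body, the recursive call on y ∷ z ∷ w ∷ u is rejected by the termination checker.
  swapAll-involutive : ∀ u → swapAll (swapAll u) ≡ u
  swapAll-involutive (x ∷ y ∷ z ∷ w ∷ u)
    with marked x (y , z) w in e | swapAll-involutive (w ∷ u) | swapAll-involutive (y ∷ z ∷ w ∷ u)
  ... | true  | ih | _ = cong (x ∷_) (begin
    swapAfter x (swap x (y , z) w ∷² swapAll (w ∷ u))
      ≡⟨ swapAfter-marked (swapAfter w u) (swap-marked e) ⟩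
    swap x (swap x (y , z) w) w ∷² swapAll (swapAll (w ∷ u))
      ≡⟨ cong₂ _∷²_ (swap-involutive e) ih ⟩
    (y , z) ∷² (w ∷ u)
      ∎)
  ... | false | _ | ih = cong (x ∷_) (trans (swapAfter-swapAll x y (z ∷ w ∷ u) e) ih)
  swapAll-involutive [] = refl
  swapAll-involutive (x ∷ []) = refl
  swapAll-involutive (x ∷ y ∷ []) = refl
  swapAll-involutive (x ∷ y ∷ z ∷ []) = refl

  module _ {p : WindowPred} (p⇒marked : ∀ {x m w} → p x m w ≡ true → marked x m w ≡ true) where

    holdsAtHead-unmarked : ∀ u → markedAtHead u ≡ false → holdsAtHead p u ≡ false
    holdsAtHead-unmarked (x ∷ y ∷ z ∷ w ∷ _) h with p x (y , z) w in e
    ... | true  = trans (sym (p⇒marked e)) h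
    ... | false = refl
    holdsAtHead-unmarked [] _ = refl
    holdsAtHead-unmarked (x ∷ []) _ = refl
    holdsAtHead-unmarked (x ∷ y ∷ []) _ = refl
    holdsAtHead-unmarked (x ∷ y ∷ z ∷ []) _ = refl

    occurrences-across-mark : ∀ {x y z w} u → marked x (y , z) w ≡ true →
      occurrences p (x ∷ y ∷ z ∷ w ∷ u) ≡ indicator (p x (y , z) w) + occurrences p (w ∷ u)
    occurrences-across-mark {x} {y} {z} {w} u h = cong (indicator (p x (y , z) w) +_)
      (cong₂ (λ a b → indicator a + (indicator b + occurrences p (w ∷ u)))
        (holdsAtHead-unmarked (y ∷ z ∷ w ∷ u) (unmarked-after₁ h u))
        (holdsAtHead-unmarked (z ∷ w ∷ u) (unmarked-after₂ h u)))

  occurrences-swapAll : ∀ {p q : WindowPred} →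
    (∀ {x m w} → p x m w ≡ true → marked x m w ≡ true) →
    (∀ {x m w} → q x m w ≡ true → marked x m w ≡ true) →
    (∀ {x m w} → marked x m w ≡ true → q x (swap x m w) w ≡ p x m w) →
    ∀ u → occurrences q (swapAll u) ≡ occurrences p u
  occurrences-swapAll {p} {q} p⇒marked q⇒marked q∘swap≡p (x ∷ y ∷ z ∷ w ∷ u)
    with marked x (y , z) w in e
       | occurrences-swapAll p⇒marked q⇒marked q∘swap≡p (w ∷ u)
       | occurrences-swapAll p⇒marked q⇒marked q∘swap≡p (y ∷ z ∷ w ∷ u)
  ... | true | ih | _ = begin
    occurrences q (x ∷ (swap x (y , z) w ∷² swapAll (w ∷ u)))
      ≡⟨ occurrences-across-mark q⇒marked (swapAfter w u) (swap-marked e) ⟩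
    indicator (q x (swap x (y , z) w) w) + occurrences q (swapAll (w ∷ u))
      ≡⟨ cong₂ _+_ (cong indicator (q∘swap≡p e)) ih ⟩
    indicator (p x (y , z) w) + occurrences p (w ∷ u)
      ≡⟨ occurrences-across-mark p⇒marked u e ⟨
    occurrences p (x ∷ y ∷ z ∷ w ∷ u)
      ∎
  ... | false | _ | ih = cong₂ _+_ (cong indicator (trans q-unmarked (sym p-unmarked))) ih
    where
    q-unmarked : holdsAtHead q (x ∷ swapAll (y ∷ z ∷ w ∷ u)) ≡ false
    q-unmarked = holdsAtHead-unmarked q⇒marked (x ∷ swapAll (y ∷ z ∷ w ∷ u))
      (trans (markedAtHead-∷swapAll x y (z ∷ w ∷ u)) e)
    p-unmarked : holdsAtHead p (x ∷ y ∷ z ∷ w ∷ u) ≡ false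
    p-unmarked = holdsAtHead-unmarked p⇒marked (x ∷ y ∷ z ∷ w ∷ u) e
  occurrences-swapAll _ _ _ [] = refl
  occurrences-swapAll _ _ _ (x ∷ []) = refl
  occurrences-swapAll _ _ _ (x ∷ y ∷ []) = refl
  occurrences-swapAll _ _ _ (x ∷ y ∷ z ∷ []) = refl

  swapAll-length : ∀ u → length (swapAll u) ≡ length u
  swapAll-length (x ∷ y ∷ z ∷ w ∷ u)
    with marked x (y , z) w | swapAll-length (w ∷ u) | swapAll-length (y ∷ z ∷ w ∷ u)
  ... | true  | ih | _ = cong (3 +_) ih
  ... | false | _ | ih = cong suc ih
  swapAll-length [] = refl
  swapAll-length (x ∷ []) = refl
  swapAll-length (x ∷ y ∷ []) = refl
  swapAll-length (x ∷ y ∷ z ∷ []) = refl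

  module _ (swap-letters : LetterPreserving swap) where

    swapAll-All : ∀ {P : ℕ → Set} u → All P u → All P (swapAll u)
    swapAll-All {P} (x ∷ y ∷ z ∷ w ∷ u) (px ∷ py ∷ pz ∷ pw ∷ pu)
      with marked x (y , z) w
         | swapAll-All (w ∷ u) (pw ∷ pu)
         | swapAll-All (y ∷ z ∷ w ∷ u) (py ∷ pz ∷ pw ∷ pu)
    ... | true  | ih | _ = let (py′ , pz′) = swap-letters {P} px py pz pw in px ∷ py′ ∷ pz′ ∷ ih
    ... | false | _ | ih = px ∷ ih
    swapAll-All [] ps = ps
    swapAll-All (x ∷ []) ps = ps
    swapAll-All (x ∷ y ∷ []) ps = ps
    swapAll-All (x ∷ y ∷ z ∷ []) ps = ps

    swapAll-∈-words : ∀ k n {u} → u ∈ words k n → swapAll u ∈ words k n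
    swapAll-∈-words k n {u} u∈ with length≡ , inRange ← ∈-words⁻ n u∈ =
      ∈-words⁺ n (trans (swapAll-length u) length≡) (swapAll-All u inRange)

-- Order types of four-letter windows

opposite : ℕ → ℕ
opposite 0 = 2
opposite 1 = 1
opposite _ = 0

cmp-opposite : ∀ a b → cmp b a ≡ opposite (cmp a b)
cmp-opposite zero zero = refl
cmp-opposite zero (suc b) = refl
cmp-opposite (suc a) zero = refl
cmp-opposite (suc a) (suc b) = cmp-opposite a b

cmp-refl : ∀ a → cmp a a ≡ 1
cmp-refl zero = refl
cmp-refl (suc a) = cmp-refl a

cmp-reverse : ∀ a b c d → cmp a b ≡ cmp c d → cmp b a ≡ cmp d c
cmp-reverse a b c d e = trans (cmp-opposite a b) (trans (cong opposite e) (sym (cmp-opposite c d)))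

cmp≡1⇒≡ : ∀ {a b} → cmp a b ≡ 1 → a ≡ b
cmp≡1⇒≡ {zero} {zero} _ = refl
cmp≡1⇒≡ {suc a} {suc b} e = cong suc (cmp≡1⇒≡ e)

-- Opaque so that unification sees patternAt applications as rigid: unfolded, they block
-- on the comparisons inside orderIso and implicit window letters cannot be inferred.
opaque
  patternAt : List ℕ → WindowPred
  patternAt τ x (y , z) w = orderIso τ (x ∷ y ∷ z ∷ w ∷ [])

record SameOrder (t₁ t₂ t₃ t₄ x y z w : ℕ) : Set where
  constructor sameOrder
  field
    c₁₂ : cmp t₁ t₂ ≡ cmp x y
    c₁₃ : cmp t₁ t₃ ≡ cmp x z
    c₁₄ : cmp t₁ t₄ ≡ cmp x w
    c₂₃ : cmp t₂ t₃ ≡ cmp y z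
    c₂₄ : cmp t₂ t₄ ≡ cmp y w
    c₃₄ : cmp t₃ t₄ ≡ cmp z w

open SameOrder

≡ᵇ-true⇒≡ : ∀ {m n} → (m ≡ᵇ n) ≡ true → m ≡ n
≡ᵇ-true⇒≡ {m} {n} e = ≡ᵇ⇒≡ m n (Equivalence.from T-≡ e)

≡⇒≡ᵇ-true : ∀ {m n} → m ≡ n → (m ≡ᵇ n) ≡ true
≡⇒≡ᵇ-true {m} {n} e = Equivalence.to T-≡ (≡⇒≡ᵇ m n e)

opaque
  unfolding patternAt

  patternAt⇒SameOrder : ∀ {t₁ t₂ t₃ t₄ x y z w} →
    patternAt (t₁ ∷ t₂ ∷ t₃ ∷ t₄ ∷ []) x (y , z) w ≡ true → SameOrder t₁ t₂ t₃ t₄ x y z w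
  patternAt⇒SameOrder {t₁} {t₂} {t₃} {t₄} {x} {y} {z} {w} h
    with cmp t₁ t₂ ≡ᵇ cmp x y in e₁₂ | cmp t₁ t₃ ≡ᵇ cmp x z in e₁₃ | cmp t₁ t₄ ≡ᵇ cmp x w in e₁₄
       | cmp t₂ t₃ ≡ᵇ cmp y z in e₂₃ | cmp t₂ t₄ ≡ᵇ cmp y w in e₂₄ | cmp t₃ t₄ ≡ᵇ cmp z w in e₃₄
  ... | true | true | true | true | true | true = sameOrder
    (≡ᵇ-true⇒≡ e₁₂) (≡ᵇ-true⇒≡ e₁₃) (≡ᵇ-true⇒≡ e₁₄) (≡ᵇ-true⇒≡ e₂₃) (≡ᵇ-true⇒≡ e₂₄) (≡ᵇ-true⇒≡ e₃₄)
  patternAt⇒SameOrder () | false | _ | _ | _ | _ | _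
  patternAt⇒SameOrder () | true | false | _ | _ | _ | _
  patternAt⇒SameOrder () | true | true | false | _ | _ | _
  patternAt⇒SameOrder () | true | true | true | false | _ | _
  patternAt⇒SameOrder () | true | true | true | true | false | _
  patternAt⇒SameOrder () | true | true | true | true | true | false

  SameOrder⇒patternAt : ∀ {t₁ t₂ t₃ t₄ x y z w} →
    SameOrder t₁ t₂ t₃ t₄ x y z w → patternAt (t₁ ∷ t₂ ∷ t₃ ∷ t₄ ∷ []) x (y , z) w ≡ true
  SameOrder⇒patternAt (sameOrder e₁₂ e₁₃ e₁₄ e₂₃ e₂₄ e₃₄)
    rewrite ≡⇒≡ᵇ-true e₁₂ | ≡⇒≡ᵇ-true e₁₃ | ≡⇒≡ᵇ-true e₁₄
          | ≡⇒≡ᵇ-true e₂₃ | ≡⇒≡ᵇ-true e₂₄ | ≡⇒≡ᵇ-true e₃₄ = refl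

orderIso₂ : ∀ {a b a′ b′} → cmp a b ≡ cmp a′ b′ → orderIso (a ∷ b ∷ []) (a′ ∷ b′ ∷ []) ≡ true
orderIso₂ e rewrite ≡⇒≡ᵇ-true e = refl

orderIso₃ : ∀ {a b c a′ b′ c′} → cmp a b ≡ cmp a′ b′ → cmp a c ≡ cmp a′ c′ → cmp b c ≡ cmp b′ c′ →
  orderIso (a ∷ b ∷ c ∷ []) (a′ ∷ b′ ∷ c′ ∷ []) ≡ true
orderIso₃ e₁₂ e₁₃ e₂₃ rewrite ≡⇒≡ᵇ-true e₁₂ | ≡⇒≡ᵇ-true e₁₃ | ≡⇒≡ᵇ-true e₂₃ = refl

record NonOverlapping (α β : List ℕ) : Set where
  constructor nonOverlapping
  field
    shift₁ : orderIso (drop 1 α) (take 3 β) ≡ false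
    shift₂ : orderIso (drop 2 α) (take 2 β) ≡ false

module _ {a₁ a₂ a₃ a₄ b₁ b₂ b₃ b₄ : ℕ} where

  private
    α β : List ℕ
    α = a₁ ∷ a₂ ∷ a₃ ∷ a₄ ∷ []
    β = b₁ ∷ b₂ ∷ b₃ ∷ b₄ ∷ []

  opaque
    unfolding patternAt

    same-window⇒orderIso : ∀ {x y z w} →
      patternAt α x (y , z) w ≡ true → patternAt β x (y , z) w ≡ true → orderIso α β ≡ true
    same-window⇒orderIso {x} {y} {z} {w} h h′ = SameOrder⇒patternAt α≈β
      where
      o : SameOrder a₁ a₂ a₃ a₄ x y z w
      o = patternAt⇒SameOrder h
      o′ : SameOrder b₁ b₂ b₃ b₄ x y z w
      o′ = patternAt⇒SameOrder h′
      α≈β : SameOrder a₁ a₂ a₃ a₄ b₁ b₂ b₃ b₄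
      α≈β = sameOrder
        (trans (c₁₂ o) (sym (c₁₂ o′))) (trans (c₁₃ o) (sym (c₁₃ o′))) (trans (c₁₄ o) (sym (c₁₄ o′)))
        (trans (c₂₃ o) (sym (c₂₃ o′))) (trans (c₂₄ o) (sym (c₂₄ o′))) (trans (c₃₄ o) (sym (c₃₄ o′)))

  shift₁⇒orderIso : ∀ {x y z w r} → patternAt α x (y , z) w ≡ true → patternAt β y (z , w) r ≡ true →
    orderIso (drop 1 α) (take 3 β) ≡ true
  shift₁⇒orderIso {x} {y} {z} {w} {r} h h′ =
    orderIso₃ {a₂} {a₃} {a₄} {b₁} {b₂} {b₃}
      (trans (c₂₃ o) (sym (c₁₂ o′))) (trans (c₂₄ o) (sym (c₁₃ o′))) (trans (c₃₄ o) (sym (c₂₃ o′)))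
    where
    o : SameOrder a₁ a₂ a₃ a₄ x y z w
    o = patternAt⇒SameOrder h
    o′ : SameOrder b₁ b₂ b₃ b₄ y z w r
    o′ = patternAt⇒SameOrder h′

  shift₂⇒orderIso : ∀ {x y z w r s} → patternAt α x (y , z) w ≡ true → patternAt β z (w , r) s ≡ true →
    orderIso (drop 2 α) (take 2 β) ≡ true
  shift₂⇒orderIso {x} {y} {z} {w} {r} {s} h h′ =
    orderIso₂ {a₃} {a₄} {b₁} {b₂} (trans (c₃₄ o) (sym (c₁₂ o′)))
    where
    o : SameOrder a₁ a₂ a₃ a₄ x y z w
    o = patternAt⇒SameOrder h
    o′ : SameOrder b₁ b₂ b₃ b₄ z w r s
    o′ = patternAt⇒SameOrder h′

  shift₁-excluded : NonOverlapping α β → ∀ {x y z w r} →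
    patternAt α x (y , z) w ≡ true → patternAt β y (z , w) r ≡ true → ⊥
  shift₁-excluded (nonOverlapping no₁ _) h h′ = not-¬ (shift₁⇒orderIso h h′) no₁

  shift₂-excluded : NonOverlapping α β → ∀ {x y z w r s} →
    patternAt α x (y , z) w ≡ true → patternAt β z (w , r) s ≡ true → ⊥
  shift₂-excluded (nonOverlapping _ no₂) h h′ = not-¬ (shift₂⇒orderIso h h′) no₂

opaque
  unfolding patternAt

  occ≡occurrences : ∀ {t₁ t₂ t₃ t₄} u →
    occ (t₁ ∷ t₂ ∷ t₃ ∷ t₄ ∷ []) u ≡ occurrences (patternAt (t₁ ∷ t₂ ∷ t₃ ∷ t₄ ∷ [])) u
  occ≡occurrences [] = refl
  occ≡occurrences (a ∷ []) = refl
  occ≡occurrences (a ∷ b ∷ []) = refl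
  occ≡occurrences (a ∷ b ∷ c ∷ []) = refl
  occ≡occurrences {t₁} {t₂} {t₃} {t₄} (a ∷ u@(b ∷ c ∷ d ∷ _)) =
    cong (indicator (patternAt (t₁ ∷ t₂ ∷ t₃ ∷ t₄ ∷ []) a (b , c) d) +_) (occ≡occurrences u)

∨-excludes : ∀ {a₁ a₂ b₁ b₂} →
  (a₁ ≡ true → b₁ ≡ true → ⊥) → (a₁ ≡ true → b₂ ≡ true → ⊥) →
  (a₂ ≡ true → b₁ ≡ true → ⊥) → (a₂ ≡ true → b₂ ≡ true → ⊥) →
  a₁ ∨ a₂ ≡ true → b₁ ∨ b₂ ≡ true → ⊥
∨-excludes {true}  {_} {true}  f _ _ _ _ _ = f refl refl
∨-excludes {true}  {_} {false} _ f _ _ _ h = f refl h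
∨-excludes {false} {_} {true}  _ _ f _ h _ = f h refl
∨-excludes {false} {_} {false} _ _ _ f h h′ = f h h′

-- Strong Wilf-equivalence from a middle swap

record MiddleSwap (t₁ t₂ t₃ t₄ s₁ s₂ s₃ s₄ : ℕ) : Set₁ where
  field
    forward backward : ℕ → ℕ × ℕ → ℕ → ℕ × ℕ
    forward-order : ∀ {x y z w} → SameOrder t₁ t₂ t₃ t₄ x y z w →
      SameOrder s₁ s₂ s₃ s₄ x (proj₁ (forward x (y , z) w)) (proj₂ (forward x (y , z) w)) w
    backward-order : ∀ {x y z w} → SameOrder s₁ s₂ s₃ s₄ x y z w →
      SameOrder t₁ t₂ t₃ t₄ x (proj₁ (backward x (y , z) w)) (proj₂ (backward x (y , z) w)) w
    backward∘forward : ∀ {x y z w} → SameOrder t₁ t₂ t₃ t₄ x y z w →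
      backward x (forward x (y , z) w) w ≡ (y , z)
    forward∘backward : ∀ {x y z w} → SameOrder s₁ s₂ s₃ s₄ x y z w →
      forward x (backward x (y , z) w) w ≡ (y , z)
    forward-letters  : LetterPreserving forward
    backward-letters : LetterPreserving backward

module _ {t₁ t₂ t₃ t₄ s₁ s₂ s₃ s₄ : ℕ} (S : MiddleSwap t₁ t₂ t₃ t₄ s₁ s₂ s₃ s₄)
  (distinct : orderIso (t₁ ∷ t₂ ∷ t₃ ∷ t₄ ∷ []) (s₁ ∷ s₂ ∷ s₃ ∷ s₄ ∷ []) ≡ false)
  (ττ : NonOverlapping (t₁ ∷ t₂ ∷ t₃ ∷ t₄ ∷ []) (t₁ ∷ t₂ ∷ t₃ ∷ t₄ ∷ []))
  (τσ : NonOverlapping (t₁ ∷ t₂ ∷ t₃ ∷ t₄ ∷ []) (s₁ ∷ s₂ ∷ s₃ ∷ s₄ ∷ []))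
  (στ : NonOverlapping (s₁ ∷ s₂ ∷ s₃ ∷ s₄ ∷ []) (t₁ ∷ t₂ ∷ t₃ ∷ t₄ ∷ []))
  (σσ : NonOverlapping (s₁ ∷ s₂ ∷ s₃ ∷ s₄ ∷ []) (s₁ ∷ s₂ ∷ s₃ ∷ s₄ ∷ []))
  where

  private
    open MiddleSwap S

    τ σ : List ℕ
    τ = t₁ ∷ t₂ ∷ t₃ ∷ t₄ ∷ []
    σ = s₁ ∷ s₂ ∷ s₃ ∷ s₄ ∷ []

    forward-pattern : ∀ {x m w} →
      patternAt τ x m w ≡ true → patternAt σ x (forward x m w) w ≡ true
    forward-pattern h = SameOrder⇒patternAt (forward-order (patternAt⇒SameOrder h))

    backward-pattern : ∀ {x m w} →
      patternAt σ x m w ≡ true → patternAt τ x (backward x m w) w ≡ true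
    backward-pattern h = SameOrder⇒patternAt (backward-order (patternAt⇒SameOrder h))

    σ-excludes-τ : ∀ {x m w} → patternAt σ x m w ≡ true → patternAt τ x m w ≡ false
    σ-excludes-τ h′ = ¬-not (λ h → not-¬ (same-window⇒orderIso h h′) distinct)

    τ-excludes-σ : ∀ {x m w} → patternAt τ x m w ≡ true → patternAt σ x m w ≡ false
    τ-excludes-σ h = ¬-not (λ h′ → not-¬ (same-window⇒orderIso h h′) distinct)

    marked : WindowPred
    marked x m w = patternAt τ x m w ∨ patternAt σ x m w

    swap : ℕ → ℕ × ℕ → ℕ → ℕ × ℕ
    swap x m w = if patternAt τ x m w then forward x m w else backward x m w

    τ⇒marked : ∀ {x m w} → patternAt τ x m w ≡ true → marked x m w ≡ true
    τ⇒marked {x} {m} {w} h = cong (_∨ patternAt σ x m w) h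

    σ⇒marked : ∀ {x m w} → patternAt σ x m w ≡ true → marked x m w ≡ true
    σ⇒marked {x} {m} {w} h = trans (cong (patternAt τ x m w ∨_) h) (∨-zeroʳ _)

    swap-matched : ∀ {x m w} → patternAt τ x m w ≡ true → swap x m w ≡ forward x m w
    swap-matched {x} {m} {w} h = cong (λ b → if b then forward x m w else backward x m w) h

    swap-unmatched : ∀ {x m w} → patternAt τ x m w ≡ false → swap x m w ≡ backward x m w
    swap-unmatched {x} {m} {w} h = cong (λ b → if b then forward x m w else backward x m w) h

    swap-marked : ∀ {x m w} → marked x m w ≡ true → marked x (swap x m w) w ≡ true
    swap-marked {x} {m} {w} h with patternAt τ x m w in e
    ... | true  = σ⇒marked (forward-pattern e)
    ... | false = τ⇒marked (backward-pattern h)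

    swap-involutive : ∀ {x m w} → marked x m w ≡ true → swap x (swap x m w) w ≡ m
    swap-involutive {x} {m} {w} h with patternAt τ x m w in e
    ... | true  = trans (swap-unmatched (σ-excludes-τ (forward-pattern e)))
                        (backward∘forward (patternAt⇒SameOrder e))
    ... | false = trans (swap-matched (backward-pattern h)) (forward∘backward (patternAt⇒SameOrder h))

    σ∘swap≡τ : ∀ {x m w} → marked x m w ≡ true →
      patternAt σ x (swap x m w) w ≡ patternAt τ x m w
    σ∘swap≡τ {x} {m} {w} h with patternAt τ x m w in e
    ... | true  = forward-pattern e
    ... | false = τ-excludes-σ (backward-pattern h)

    no-overlap₁ : ∀ {x y z w r} → marked x (y , z) w ≡ true → marked y (z , w) r ≡ true → ⊥
    no-overlap₁ {x} {y} {z} {w} {r} = ∨-excludes (shift₁-excluded ττ {x} {y} {z} {w} {r})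
      (shift₁-excluded τσ) (shift₁-excluded στ) (shift₁-excluded σσ)

    no-overlap₂ : ∀ {x y z w r s} → marked x (y , z) w ≡ true → marked z (w , r) s ≡ true → ⊥
    no-overlap₂ {x} {y} {z} {w} {r} {s} = ∨-excludes (shift₂-excluded ττ {x} {y} {z} {w} {r} {s})
      (shift₂-excluded τσ) (shift₂-excluded στ) (shift₂-excluded σσ)

    swap-letters : LetterPreserving swap
    swap-letters {P} {x} {y} {z} {w} px py pz pw with patternAt τ x (y , z) w
    ... | true  = forward-letters {P} px py pz pw
    ... | false = backward-letters {P} px py pz pw

    open WindowSwap marked swap swap-marked swap-involutive no-overlap₁ no-overlap₂

    occ-swapAll : ∀ u → occ σ (swapAll u) ≡ occ τ u
    occ-swapAll u = begin
      occ σ (swapAll u)                      ≡⟨ occ≡occurrences (swapAll u) ⟩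
      occurrences (patternAt σ) (swapAll u)  ≡⟨ occurrences-swapAll τ⇒marked σ⇒marked σ∘swap≡τ u ⟩
      occurrences (patternAt τ) u            ≡⟨ occ≡occurrences u ⟨
      occ τ u                                ∎
      where open ≡-Reasoning

  middleSwap⇒stronglyWilfEquiv : StronglyWilfEquiv (t₁ ∷ t₂ ∷ t₃ ∷ t₄ ∷ []) (s₁ ∷ s₂ ∷ s₃ ∷ s₄ ∷ [])
  middleSwap⇒stronglyWilfEquiv k n r _ = count-≡-by-involution τ σ swapAll swapAll-involutive
    (swapAll-∈-words (λ {P} → swap-letters {P})) occ-swapAll k n r

open MiddleSwap

transposeMiddle : ∀ {t₁ t₂ t₃ t₄} → MiddleSwap t₁ t₂ t₃ t₄ t₁ t₃ t₂ t₄
transposeMiddle .forward _ (y , z) _ = (z , y)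
transposeMiddle .backward _ (y , z) _ = (z , y)
transposeMiddle {t₂ = t₂} {t₃} .forward-order {y = y} {z} (sameOrder e₁₂ e₁₃ e₁₄ e₂₃ e₂₄ e₃₄) =
  sameOrder e₁₃ e₁₂ e₁₄ (cmp-reverse t₂ t₃ y z e₂₃) e₃₄ e₂₄
transposeMiddle {t₂ = t₂} {t₃} .backward-order {y = y} {z} (sameOrder e₁₂ e₁₃ e₁₄ e₂₃ e₂₄ e₃₄) =
  sameOrder e₁₃ e₁₂ e₁₄ (cmp-reverse t₃ t₂ y z e₂₃) e₃₄ e₂₄
transposeMiddle .backward∘forward _ = refl
transposeMiddle .forward∘backward _ = refl
transposeMiddle .forward-letters _ py pz _ = pz , py
transposeMiddle .backward-letters _ py pz _ = pz , py

-- An occurrence x x z w of 1132 becomes x w z w, and an occurrence x y z y of 1232 becomes x x z y.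
swap-1132-1232 : MiddleSwap 1 1 3 2 1 2 3 2
swap-1132-1232 .forward _ (_ , z) w = (w , z)
swap-1132-1232 .backward x (_ , z) _ = (x , z)
swap-1132-1232 .forward-order {z = z} {w} (sameOrder _ e₁₃ e₁₄ _ _ e₃₄) =
  sameOrder e₁₄ e₁₃ e₁₄ (cmp-reverse 3 2 z w e₃₄) (sym (cmp-refl w)) e₃₄
swap-1132-1232 .backward-order {x} (sameOrder _ e₁₃ e₁₄ _ _ e₃₄) =
  sameOrder (sym (cmp-refl x)) e₁₃ e₁₄ e₁₃ e₁₄ e₃₄
swap-1132-1232 .backward∘forward {z = z} (sameOrder e₁₂ _ _ _ _ _) = cong (_, z) (cmp≡1⇒≡ (sym e₁₂))
swap-1132-1232 .forward∘backward {z = z} (sameOrder _ _ _ _ e₂₄ _) =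
  cong (_, z) (sym (cmp≡1⇒≡ (sym e₂₄)))
swap-1132-1232 .forward-letters _ _ pz pw = pw , pz
swap-1132-1232 .backward-letters px _ pz _ = px , pz

-- An occurrence x y z y of 1232 becomes x z z y, and an occurrence x y y w of 1332 becomes x w y w.
swap-1232-1332 : MiddleSwap 1 2 3 2 1 3 3 2
swap-1232-1332 .forward _ (_ , z) _ = (z , z)
swap-1232-1332 .backward _ (y , _) w = (w , y)
swap-1232-1332 .forward-order {z = z} (sameOrder _ e₁₃ e₁₄ _ _ e₃₄) =
  sameOrder e₁₃ e₁₃ e₁₄ (sym (cmp-refl z)) e₃₄ e₃₄
swap-1232-1332 .backward-order {y = y} {w = w} (sameOrder e₁₂ _ e₁₄ _ e₂₄ _) =
  sameOrder e₁₄ e₁₂ e₁₄ (cmp-reverse 3 2 y w e₂₄) (sym (cmp-refl w)) e₂₄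
swap-1232-1332 .backward∘forward {z = z} (sameOrder _ _ _ _ e₂₄ _) =
  cong (_, z) (sym (cmp≡1⇒≡ (sym e₂₄)))
swap-1232-1332 .forward∘backward {y = y} (sameOrder _ _ _ e₂₃ _ _) = cong (y ,_) (cmp≡1⇒≡ (sym e₂₃))
swap-1232-1332 .forward-letters _ _ pz _ = pz , pz
swap-1232-1332 .backward-letters _ py _ pw = pw , py

stronglyWilfEquiv-trans : ∀ {τ ρ π} →
  StronglyWilfEquiv τ ρ → StronglyWilfEquiv ρ π → StronglyWilfEquiv τ π
stronglyWilfEquiv-trans τ~ρ ρ~π k n r k≥1 = trans (τ~ρ k n r k≥1) (ρ~π k n r k≥1)

corollary4p5 :
    (StronglyWilfEquiv (1 ∷ 1 ∷ 3 ∷ 2 ∷ []) (1 ∷ 2 ∷ 3 ∷ 2 ∷ [])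
      × StronglyWilfEquiv (1 ∷ 1 ∷ 3 ∷ 2 ∷ []) (1 ∷ 3 ∷ 2 ∷ 2 ∷ [])
      × StronglyWilfEquiv (1 ∷ 1 ∷ 3 ∷ 2 ∷ []) (1 ∷ 3 ∷ 3 ∷ 2 ∷ []))
    × StronglyWilfEquiv (1 ∷ 4 ∷ 3 ∷ 2 ∷ []) (1 ∷ 3 ∷ 4 ∷ 2 ∷ [])
corollary4p5 =
  ( 1132~1232
  , stronglyWilfEquiv-trans 1132~1232 1232~1322
  , stronglyWilfEquiv-trans 1132~1232 1232~1332 )
  , 1432~1342
  where
  1132~1232 : StronglyWilfEquiv (1 ∷ 1 ∷ 3 ∷ 2 ∷ []) (1 ∷ 2 ∷ 3 ∷ 2 ∷ [])
  1132~1232 = middleSwap⇒stronglyWilfEquiv swap-1132-1232 refl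
    (nonOverlapping refl refl) (nonOverlapping refl refl) (nonOverlapping refl refl) (nonOverlapping refl refl)

  1232~1322 : StronglyWilfEquiv (1 ∷ 2 ∷ 3 ∷ 2 ∷ []) (1 ∷ 3 ∷ 2 ∷ 2 ∷ [])
  1232~1322 = middleSwap⇒stronglyWilfEquiv transposeMiddle refl
    (nonOverlapping refl refl) (nonOverlapping refl refl) (nonOverlapping refl refl) (nonOverlapping refl refl)

  1232~1332 : StronglyWilfEquiv (1 ∷ 2 ∷ 3 ∷ 2 ∷ []) (1 ∷ 3 ∷ 3 ∷ 2 ∷ [])
  1232~1332 = middleSwap⇒stronglyWilfEquiv swap-1232-1332 refl
    (nonOverlapping refl refl) (nonOverlapping refl refl) (nonOverlapping refl refl) (nonOverlapping refl refl)

  1432~1342 : StronglyWilfEquiv (1 ∷ 4 ∷ 3 ∷ 2 ∷ []) (1 ∷ 3 ∷ 4 ∷ 2 ∷ [])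
  1432~1342 = middleSwap⇒stronglyWilfEquiv transposeMiddle refl
    (nonOverlapping refl refl) (nonOverlapping refl refl) (nonOverlapping refl refl) (nonOverlapping refl refl)
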